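{- Let $X$ be a weighted sequence of length $n$, let $\epsilon>0$, let $z=\frac1\epsilon$, and let $\mathcal{S}$ be a $z$-estimation of $X$. Let $z'$ satisfy $\frac{1}{z'}\ge\epsilon$ and set $\ell=\lfloor\frac{z}{z'}\rfloor$. Then for every string $P$ and position $i$: if $\mathit{Count}_{\mathcal{S}}(P,i)\ge\ell$ then $\mathcal{P}_X(P,i)\ge\frac{1}{z'}-\epsilon$, and if $\mathit{Count}_{\mathcal{S}}(P,i)<\ell$ then $\mathcal{P}_X(P,i)<\frac{1}{z'}$.
   Context: A weighted sequence $X$ of length $n$ over $\Sigma$ assigns to every position $i$ and letter $c$ a probability $p_i(c)\ge0$ with $\sum_c p_i(c)=1$; $\mathcal{P}_X(P,i)=\prod_{j=1}^{|P|}p_{i+j-1}(P[j])$ (zero if $P$ extends beyond position $n$). A property of a string $S$ of length $n$ is a non-decreasing array $\pi[1..n]$ with $\pi[i]\in\{i-1,\ldots,n\}$; $\mathit{Occ}_\pi(P,S)$ is the set of $i$ with $P=S[i..i+|P|-1]$ and $i+|P|-1\le\pi[i]$. For a family $\mathcal{S}=(S_j,\pi_j)_{j=1}^k$, $\mathit{Count}_{\mathcal{S}}(P,i)=|\{j:i\in\mathit{Occ}_{\pi_j}(P,S_j)\}|$. A $z$-estimation of $X$ is a family $(S_j,\pi_j)_{j=1}^{\lfloor z\rfloor}$ of strings of length $n$ with properties such that $\mathit{Count}_{\mathcal{S}}(P,i)=\lfloor\mathcal{P}_X(P,i)z\rfloor$ for all strings $P$ and all $i\in\{1,\ldots,n\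}$.
   Formalization: The probabilities $p_i(c)$ of the weighted sequence $X$ and the parameters ε and $z'$ are rational numbers. -}

module Defs where

open import Data.Nat as ℕ using (ℕ; zero; suc; _<_; _≤_; _<?_; _≤?_; _+_)
open import Data.Fin using (Fin; fromℕ<)
open import Data.Fin.Properties using (_≟_)
import Data.Nat.Properties as NP
import Data.Fin
open import Data.List using (List; []; _∷_; length; filter; foldr)
open import Data.List.Base using (allFin)
open import Data.Product using (Σ; _×_; _,_)
open import Data.Unit using (⊤; tt)
open import Data.Integer as ℤ using (ℤ; +_)
open import Data.Rational as ℚ using (ℚ; 0ℚ; 1ℚ; floor; 1/_; >-nonZero)
open import Relation.Binary.PropositionalEquality using (_≡_)
open import Relation.Nullary using (Dec; yes; no; ¬_)
open import Relation.Nullary.Decidable using (_×-dec_)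

-- Alphabet Σ = Fin σ.  Positions are 0-based: position i ∈ {0,…,n-1}
-- corresponds to the paper's 1-based position i+1.

sumFin : (σ : ℕ) → (Fin σ → ℚ) → ℚ
sumFin σ f = foldr (λ c acc → f c ℚ.+ acc) 0ℚ (allFin σ)

record WeightedSeq (σ n : ℕ) : Set where
  field
    p        : Fin n → Fin σ → ℚ
    p-nonneg : ∀ i c → 0ℚ ℚ.≤ p i c
    p-sum1   : ∀ i → sumFin σ (p i) ≡ 1ℚ
open WeightedSeq public

probAt : ∀ {σ n} → WeightedSeq σ n → List (Fin σ) → ℕ → ℚ
probAt X []      i = 1ℚ
probAt {n = n} X (c ∷ P) i with i <? n
... | yes h = p X (fromℕ< h) c ℚ.* probAt X P (suc i)
... | no  _ = 0ℚ

-- A property of a string of length n: non-decreasing π with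
-- π[i] ∈ {i,…,n} (0-based; the paper's π[i+1] ∈ {(i+1)-1,…,n}).
record Property (n : ℕ) : Set where
  field
    π        : Fin n → ℕ
    π-lower  : ∀ i → Data.Fin.toℕ i ≤ π i
    π-upper  : ∀ i → π i ≤ n
    π-mono   : ∀ i j → i Data.Fin.≤ j → π i ≤ π j
open Property public

MatchesAt : ∀ {σ n} → (Fin n → Fin σ) → List (Fin σ) → ℕ → Set
MatchesAt S []      i = ⊤
MatchesAt {n = n} S (c ∷ P) i = Σ (i < n) λ h → (S (fromℕ< h) ≡ c) × MatchesAt S P (suc i)

matchesAt? : ∀ {σ n} (S : Fin n → Fin σ) (P : List (Fin σ)) (i : ℕ) → Dec (MatchesAt S P i)
matchesAt? S []      i = yes tt
matchesAt? {n = n} S (c ∷ P) i with i <? n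
... | no ¬h = no λ { (h , _) → ¬h h }
... | yes h with S (fromℕ< h) ≟ c | matchesAt? S P (suc i)
...   | yes e | yes m = yes (h , e , m)
...   | no ¬e | _     = no λ { (h' , e , _) → ¬e (Eq-help h h' e) }
  where
    Eq-help : (a b : i < n) → S (fromℕ< b) ≡ c → S (fromℕ< a) ≡ c
    Eq-help a b e rewrite NP.<-irrelevant a b = e
...   | yes _ | no ¬m = no λ { (h' , _ , m) → ¬m m }

-- i ∈ Occ_π(P,S)  (0-based: i + |P| ≤ π[i], i.e. paper's i+|P|-1 ≤ π[i])
Occ : ∀ {σ n} → (Fin n → Fin σ) → Property n → List (Fin σ) → Fin n → Set
Occ S pr P i = MatchesAt S P (Data.Fin.toℕ i) × (Data.Fin.toℕ i + length P ≤ π pr i)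

occ? : ∀ {σ n} (S : Fin n → Fin σ) (pr : Property n) (P : List (Fin σ)) (i : Fin n) → Dec (Occ S pr P i)
occ? S pr P i = matchesAt? S P (Data.Fin.toℕ i) ×-dec (Data.Fin.toℕ i + length P ≤? π pr i)

Family : (σ n k : ℕ) → Set
Family σ n k = Fin k → (Fin n → Fin σ) × Property n

Count : ∀ {σ n k} → Family σ n k → List (Fin σ) → Fin n → ℕ
Count {k = k} F P i =
  length (filter (λ j → occ? (Data.Product.proj₁ (F j)) (Data.Product.proj₂ (F j)) P i) (allFin k))

floorℕ : ℚ → ℕ
floorℕ q = ℤ.∣ floor q ∣

IsZEstimation : ∀ {σ n} → WeightedSeq σ n → (z : ℚ) → Family σ n (floorℕ z) → Set
IsZEstimation X z F = ∀ (P : List _) (i : Fin _) →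
  + Count F P i ≡ floor (probAt X P (Data.Fin.toℕ i) ℚ.* z)

inv : (q : ℚ) → 0ℚ ℚ.< q → ℚ
inv q h = (1/ q) {{>-nonZero h}}

-- Being a z-estimation gives Count(P,i) = ⌊z p⌋ for p = 𝒫_X(P,i), while ℓ = ⌊z w⌋ for w = 1/z′.
-- For floors, ⌊a⌋ ≤ ⌊b⌋ forces a < b + 1 and ⌊a⌋ < ⌊b⌋ forces a < b; so ℓ ≤ Count gives
-- z w < z p + 1 = z (p + ε), and Count < ℓ gives z p < z w. Cancelling z > 0 yields both bounds.
module Submission where

open import Defs
open import Data.Fin using (Fin; toℕ)
open import Data.List using (List)
open import Data.Product using (_×_; _,_)
open import Data.Nat as ℕ using (ℕ)
open import Data.Integer as ℤ using (+_) renaming (suc to sucℤ)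
import Data.Integer.Properties as ℤP
import Data.Integer.DivMod as ℤD
open import Data.Rational as ℚ using (ℚ; 0ℚ; 1ℚ; floor; mkℚ; *≤*; *<*)
open import Data.Rational.Literals using (fromℤ)
import Data.Rational.Properties as ℚP
import Data.Rational.Unnormalised as ℚᵘ
import Data.Rational.Unnormalised.Properties as ℚᵘP
open import Relation.Binary.PropositionalEquality

fromℤ-mono-≤ : ∀ {a b} → a ℤ.≤ b → fromℤ a ℚ.≤ fromℤ b
fromℤ-mono-≤ {a} {b} a≤b = *≤* (subst₂ ℤ._≤_ (sym (ℤP.*-identityʳ a)) (sym (ℤP.*-identityʳ b)) a≤b)

fromℤ-suc : ∀ a → fromℤ (sucℤ a) ≡ fromℤ a ℚ.+ 1ℚ
fromℤ-suc a = ℚP.toℚᵘ-injective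
  (ℚᵘP.≃-trans (ℚᵘ.*≡* numerators) (ℚᵘP.≃-sym (ℚP.toℚᵘ-homo-+ (fromℤ a) 1ℚ)))
  where
  open ≡-Reasoning
  numerators : sucℤ a ℤ.* + 1 ≡ (a ℤ.* + 1 ℤ.+ + 1 ℤ.* + 1) ℤ.* + 1
  numerators = begin
    sucℤ a ℤ.* + 1                    ≡⟨ ℤP.*-identityʳ _ ⟩
    + 1 ℤ.+ a                         ≡⟨ ℤP.+-comm (+ 1) a ⟩
    a ℤ.+ + 1                         ≡⟨ cong (ℤ._+ + 1) (sym (ℤP.*-identityʳ a)) ⟩
    a ℤ.* + 1 ℤ.+ + 1                 ≡⟨ sym (ℤP.*-identityʳ _) ⟩
    (a ℤ.* + 1 ℤ.+ + 1 ℤ.* + 1) ℤ.* + 1 ∎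

fromℤ-floor-≤ : ∀ q → fromℤ (floor q) ℚ.≤ q
fromℤ-floor-≤ (mkℚ n d _) =
  *≤* (subst (ℤ._≤_ _) (sym (ℤP.*-identityʳ n)) (ℤD.[n/d]*d≤n n (+ ℕ.suc d)))

<-fromℤ-suc-floor : ∀ q → q ℚ.< fromℤ (sucℤ (floor q))
<-fromℤ-suc-floor (mkℚ n d _) = *<* (subst₂ ℤ._<_ (sym (ℤP.*-identityʳ n))
  (cong (λ k → sucℤ k ℤ.* + ℕ.suc d) (sym (ℤD.div-pos-is-/ℕ n (ℕ.suc d))))
  (ℤD.n<s[n/ℕd]*d n (ℕ.suc d)))

floor-≤⇒<+1 : ∀ {p q} → floor p ℤ.≤ floor q → p ℚ.< q ℚ.+ 1ℚ
floor-≤⇒<+1 {p} {q} ⌊p⌋≤⌊q⌋ = begin-strict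
  p                        <⟨ <-fromℤ-suc-floor p ⟩
  fromℤ (sucℤ (floor p))   ≡⟨ fromℤ-suc (floor p) ⟩
  fromℤ (floor p) ℚ.+ 1ℚ   ≤⟨ ℚP.+-monoˡ-≤ 1ℚ (fromℤ-mono-≤ ⌊p⌋≤⌊q⌋) ⟩
  fromℤ (floor q) ℚ.+ 1ℚ   ≤⟨ ℚP.+-monoˡ-≤ 1ℚ (fromℤ-floor-≤ q) ⟩
  q ℚ.+ 1ℚ                 ∎
  where open ℚP.≤-Reasoning

floor-<⇒< : ∀ {p q} → floor p ℤ.< floor q → p ℚ.< q
floor-<⇒< {p} {q} ⌊p⌋<⌊q⌋ = begin-strict
  p                        <⟨ <-fromℤ-suc-floor p ⟩
  fromℤ (sucℤ (floor p))   ≤⟨ fromℤ-mono-≤ (ℤP.i<j⇒suc[i]≤j ⌊p⌋<⌊q⌋) ⟩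
  fromℤ (floor q)          ≤⟨ fromℤ-floor-≤ q ⟩
  q                        ∎
  where open ℚP.≤-Reasoning

p+q-q≡p : ∀ p q → p ℚ.+ q ℚ.- q ≡ p
p+q-q≡p p q = begin
  p ℚ.+ q ℚ.- q       ≡⟨ ℚP.+-assoc p q (ℚ.- q) ⟩
  p ℚ.+ (q ℚ.- q)     ≡⟨ cong (p ℚ.+_) (ℚP.+-inverseʳ q) ⟩
  p ℚ.+ 0ℚ            ≡⟨ ℚP.+-identityʳ p ⟩
  p                   ∎
  where open ≡-Reasoning

module ScaledByInverse (ε : ℚ) (ε>0 : 0ℚ ℚ.< ε) where

  z : ℚ
  z = inv ε ε>0

  instance
    z-nonNegative : ℚ.NonNegative z
    z-nonNegative = ℚP.pos⇒nonNeg z {{ℚP.1/pos⇒pos ε {{ℚ.positive ε>0}}}}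

  ε*z≡1 : ε ℚ.* z ≡ 1ℚ
  ε*z≡1 = ℚP.*-inverseʳ ε {{ℚ.>-nonZero ε>0}}

  ⌊zw⌋≤⌊pz⌋⇒w-ε≤p : ∀ p w → floor (z ℚ.* w) ℤ.≤ floor (p ℚ.* z) → w ℚ.- ε ℚ.≤ p
  ⌊zw⌋≤⌊pz⌋⇒w-ε≤p p w ⌊zw⌋≤⌊pz⌋ =
    ℚP.<⇒≤ (subst (w ℚ.- ε ℚ.<_) (p+q-q≡p p ε) (ℚP.+-monoˡ-< (ℚ.- ε) w<p+ε))
    where
    w<p+ε : w ℚ.< p ℚ.+ ε
    w<p+ε = ℚP.*-cancelʳ-<-nonNeg z (subst₂ ℚ._<_ (ℚP.*-comm z w)
      (trans (cong (p ℚ.* z ℚ.+_) (sym ε*z≡1)) (sym (ℚP.*-distribʳ-+ z p ε)))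
      (floor-≤⇒<+1 {z ℚ.* w} {p ℚ.* z} ⌊zw⌋≤⌊pz⌋))

  ⌊pz⌋<⌊zw⌋⇒p<w : ∀ p w → floor (p ℚ.* z) ℤ.< floor (z ℚ.* w) → p ℚ.< w
  ⌊pz⌋<⌊zw⌋⇒p<w p w ⌊pz⌋<⌊zw⌋ =
    ℚP.*-cancelʳ-<-nonNeg z (subst (p ℚ.* z ℚ.<_) (ℚP.*-comm z w) (floor-<⇒< {p ℚ.* z} {z ℚ.* w} ⌊pz⌋<⌊zw⌋))

-- The hypothesis ε ≤ 1/z′ only makes the first bound non-trivial; the proof does not need it.
lemma3 : ∀ {σ n : ℕ} (X : WeightedSeq σ n) (ε : ℚ) (ε>0 : 0ℚ ℚ.< ε)
           (𝒮 : Family σ n (floorℕ (inv ε ε>0)))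
           → IsZEstimation X (inv ε ε>0) 𝒮
           → (z′ : ℚ) (z′>0 : 0ℚ ℚ.< z′)
           → ε ℚ.≤ inv z′ z′>0
           → ∀ (P : List (Fin σ)) (i : Fin n)
           → (floor (inv ε ε>0 ℚ.* inv z′ z′>0) ℤ.≤ + Count 𝒮 P i
                → inv z′ z′>0 ℚ.- ε ℚ.≤ probAt X P (toℕ i))
             × (+ Count 𝒮 P i ℤ.< floor (inv ε ε>0 ℚ.* inv z′ z′>0)
                → probAt X P (toℕ i) ℚ.< inv z′ z′>0)
lemma3 X ε ε>0 𝒮 estimation z′ z′>0 _ P i rewrite estimation P i =
  ⌊zw⌋≤⌊pz⌋⇒w-ε≤p (probAt X P (toℕ i)) (inv z′ z′>0) ,
  ⌊pz⌋<⌊zw⌋⇒p<w (probAt X P (toℕ i)) (inv z′ z′>0)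
  where open ScaledByInverse ε ε>0
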